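{- Let $\varphi$ be a formula built from atomic variables and constants $0,1$ using $\vee,\wedge,\Rightarrow$, let $\pi$ be an atomic variable not occurring in $\varphi$, and let $\varphi^g_\pi$ be the Gödel $\pi$-transform of $\varphi$. Then $\varphi$ is a subset tautology if and only if $(\varphi^g_\pi\Rightarrow\pi)\Rightarrow\pi$ is a partition tautology.
   Context: Write $\overset{\pi}{\lnot}\psi$ for $\psi\Rightarrow\pi$. Gödel $\pi$-transform, defined recursively: if $\varphi$ is atomic, $\varphi^g_\pi=\varphi\vee\pi$; $0^g_\pi=\pi$, $1^g_\pi=1$; $(\sigma\vee\tau)^g_\pi=\sigma^g_\pi\vee\tau^g_\pi$; $(\sigma\Rightarrow\tau)^g_\pi=\sigma^g_\pi\Rightarrow\tau^g_\pi$; $(\sigma\wedge\tau)^g_\pi=\overset{\pi}{\lnot}\overset{\pi}{\lnot}\sigma^g_\pi\wedge\overset{\pi}{\lnot}\overset{\pi}{\lnot}\tau^g_\pi$. Subset semantics: for a nonempty set $U$, assign subsets to variables, $0=\emptyset$, $1=U$, $\vee=\cup$, $\wedge=\cap$, $A\Rightarrow B=(U\setminus A)\cup B$; a subset tautology evaluates to $U$ for all nonempty $U$ and all assignments. Partition semantics: for a set $U$ with $|U|\ge2$, assign partitions on $U$ (sets of nonempty pairwise disjoint blocks with union $U$) to the variables; with $\operatorname{dit}(\pi)$ the ordered pairs in different blocks, $\overline S$ the smallest equivalence relation containing $S\subseteq U\times U$ and $\operatorname{int}(S)=U\times U\setminus\overline{U\times U\setminus S}$: $0=\{U\}$, $1$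 = discrete partition, $\operatorname{dit}(\sigma\vee\tau)=\operatorname{dit}\sigma\cup\operatorname{dit}\tau$, $\operatorname{dit}(\sigma\wedge\tau)=\operatorname{int}(\operatorname{dit}\sigma\cap\operatorname{dit}\tau)$, $\operatorname{dit}(\sigma\Rightarrow\tau)=\operatorname{int}((U\times U\setminus\operatorname{dit}\sigma)\cup\operatorname{dit}\tau)$. A partition tautology evaluates to $1$ for all $U$ with $|U|\ge2$ and all assignments (including to $\pi$). -}

module Defs where

open import Data.Nat using (ℕ)
open import Data.Empty using (⊥)
open import Data.Unit using (⊤)
open import Data.Sum using (_⊎_)
open import Data.Product using (_×_; Σ)
open import Relation.Nullary using (¬_)
open import Relation.Binary.PropositionalEquality using (_≡_; _≢_)
open import Relation.Binary.Structures using (IsEquivalence)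
open import Function.Bundles using (_⇔_)

infixr 6 _∧′_
infixr 5 _∨′_
infixr 4 _⇒′_

data Formula : Set where
  var        : ℕ → Formula
  𝟘 𝟙        : Formula
  _∨′_ _∧′_ _⇒′_ : Formula → Formula → Formula

Occurs : ℕ → Formula → Set
Occurs n (var m)   = n ≡ m
Occurs n 𝟘         = ⊥
Occurs n 𝟙         = ⊥
Occurs n (σ ∨′ τ)  = Occurs n σ ⊎ Occurs n τ
Occurs n (σ ∧′ τ)  = Occurs n σ ⊎ Occurs n τ
Occurs n (σ ⇒′ τ)  = Occurs n σ ⊎ Occurs n τ

negπ : ℕ → Formula → Formula
negπ π ψ = ψ ⇒′ var π

godel : ℕ → Formula → Formula
godel π (var n)  = var n ∨′ var π
godel π 𝟘        = var π
godel π 𝟙        = 𝟙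
godel π (σ ∨′ τ) = godel π σ ∨′ godel π τ
godel π (σ ⇒′ τ) = godel π σ ⇒′ godel π τ
godel π (σ ∧′ τ) = negπ π (negπ π (godel π σ)) ∧′ negπ π (negπ π (godel π τ))

⟦_⟧ˢ : {U : Set} → Formula → (ℕ → U → Set) → U → Set
⟦ var n ⟧ˢ  ρ u = ρ n u
⟦ 𝟘 ⟧ˢ      ρ u = ⊥
⟦ 𝟙 ⟧ˢ      ρ u = ⊤
⟦ σ ∨′ τ ⟧ˢ ρ u = ⟦ σ ⟧ˢ ρ u ⊎ ⟦ τ ⟧ˢ ρ u
⟦ σ ∧′ τ ⟧ˢ ρ u = ⟦ σ ⟧ˢ ρ u × ⟦ τ ⟧ˢ ρ u
⟦ σ ⇒′ τ ⟧ˢ ρ u = (¬ ⟦ σ ⟧ˢ ρ u) ⊎ ⟦ τ ⟧ˢ ρ u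

SubsetTautology : Formula → Set₁
SubsetTautology φ =
  (U : Set) → U → (ρ : ℕ → U → Set) → (u : U) → ⟦ φ ⟧ˢ ρ u

BinRel : Set → Set₁
BinRel U = U → U → Set

record Partition (U : Set) : Set₁ where
  field
    SameBlock : BinRel U
    isEquivalence : IsEquivalence SameBlock

open Partition public

dit : {U : Set} → Partition U → BinRel U
dit P x y = ¬ SameBlock P x y

compl : {U : Set} → BinRel U → BinRel U
compl S x y = ¬ S x y

data EqClosure {U : Set} (S : BinRel U) : BinRel U where
  incl  : ∀ {x y} → S x y → EqClosure S x y
  refl′ : ∀ {x} → EqClosure S x x
  sym′  : ∀ {x y} → EqClosure S x y → EqClosure S y x
  trans′ : ∀ {x y z} → EqClosure S x y → EqClosure S y z → EqClosure S x z

int : {U : Set} → BinRel U → BinRel U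
int S = compl (EqClosure (compl S))

-- dit set of the value of a formula under a partition assignment
⟦_⟧ᵖ : {U : Set} → Formula → (ℕ → Partition U) → BinRel U
⟦ var n ⟧ᵖ  ρ x y = dit (ρ n) x y
⟦ 𝟘 ⟧ᵖ      ρ x y = ⊥                       -- 0 = {U}: no distinctions
⟦ 𝟙 ⟧ᵖ      ρ x y = x ≢ y                   -- 1 = discrete partition
⟦ σ ∨′ τ ⟧ᵖ ρ x y = ⟦ σ ⟧ᵖ ρ x y ⊎ ⟦ τ ⟧ᵖ ρ x y
⟦ σ ∧′ τ ⟧ᵖ ρ x y = int (λ a b → ⟦ σ ⟧ᵖ ρ a b × ⟦ τ ⟧ᵖ ρ a b) x y
⟦ σ ⇒′ τ ⟧ᵖ ρ x y = int (λ a b → compl (⟦ σ ⟧ᵖ ρ) a b ⊎ ⟦ τ ⟧ᵖ ρ a b) x y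

PartitionTautology : Formula → Set₁
PartitionTautology φ =
  (U : Set) → Σ U (λ a → Σ U (λ b → a ≢ b)) →
  (ρ : ℕ → Partition U) → (x y : U) → ⟦ φ ⟧ᵖ ρ x y ⇔ (x ≢ y)

-- The complement of every partition value is an equivalence relation: every value is the dit
-- set of a partition. Fix a π-block B with two distinct points and say that a dit set X splits
-- B if it distinguishes two points of B. Since complements of dit sets are equivalences, an
-- implication X ⇒ Y whose consequent contains dit(π) is the full relation ≢ on B when X does
-- not split B, and does not split B when X does but Y does not. Hence on B the π-transform is
-- two-valued: φ^g_π splits B iff φ holds in the one-point subset model where a variable is
-- true iff its partition splits B, and ¬^π¬^π X is ≢ on B as soon as X splits B. A subset
-- tautology therefore makes ¬^π¬^π φ^g_π discrete inside every π-block, and it contains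
-- dit(π) across blocks. Conversely, partitions of a two-point set with π indiscrete realise
-- every point of a subset model, and π does not occur in φ.
module Submission where

open import Defs
open import Data.Nat using (ℕ)
open import Level using (0ℓ)
open import Relation.Nullary using (¬_; yes; no)
open import Function.Bundles using (_⇔_; mk⇔; Equivalence)
open import Axiom.ExcludedMiddle using (ExcludedMiddle)
open import Axiom.DoubleNegationElimination using (em⇒dne)
open import Data.Bool using (Bool; true; false)
open import Data.Empty using (⊥-elim)
open import Data.Unit using (⊤; tt)
open import Data.Sum using (_⊎_; inj₁; inj₂; [_,_])
open import Data.Product using (_×_; _,_; proj₁; proj₂; ∃₂)
open import Function using (_∘_)
open import Relation.Binary.Core using (_⇒_)
open import Relation.Binary.Definitions using (Cotransitive)
open import Relation.Binary.Structures using (IsEquivalence)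
open import Relation.Binary.Construct.Union using (_∪_)
open import Relation.Binary.Construct.Intersection using (_∩_)
open import Relation.Binary.PropositionalEquality as ≡ using (_≡_; _≢_; refl)

IsDitSet : {U : Set} → BinRel U → Set
IsDitSet X = IsEquivalence (compl X)

infixr 4 _⇒ʳ_

_⇒ʳ_ : {U : Set} → BinRel U → BinRel U → BinRel U
X ⇒ʳ Y = int (compl X ∪ Y)

EqClosure-minimal : {U : Set} {R T : BinRel U} → IsEquivalence T → R ⇒ T → EqClosure R ⇒ T
EqClosure-minimal eqT R⇒T (incl r)     = R⇒T r
EqClosure-minimal eqT R⇒T refl′        = IsEquivalence.refl eqT
EqClosure-minimal eqT R⇒T (sym′ c)     = IsEquivalence.sym eqT (EqClosure-minimal eqT R⇒T c)
EqClosure-minimal eqT R⇒T (trans′ c d) =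
  IsEquivalence.trans eqT (EqClosure-minimal eqT R⇒T c) (EqClosure-minimal eqT R⇒T d)

EqClosure-isEquivalence : {U : Set} (R : BinRel U) → IsEquivalence (EqClosure R)
EqClosure-isEquivalence R = record { refl = refl′ ; sym = sym′ ; trans = trans′ }

¬-isDitSet : {U : Set} {R : BinRel U} → IsEquivalence R → IsDitSet (compl R)
¬-isDitSet eqR = record
  { refl  = λ ¬r → ¬r R.refl
  ; sym   = λ ¬¬r ¬r → ¬¬r (¬r ∘ R.sym)
  ; trans = λ ¬¬r ¬¬s ¬r → ¬¬r (λ r → ¬¬s (λ s → ¬r (R.trans r s)))
  }
  where module R = IsEquivalence eqR

∪-isDitSet : {U : Set} {X Y : BinRel U} → IsDitSet X → IsDitSet Y → IsDitSet (X ∪ Y)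
∪-isDitSet dX dY = record
  { refl  = [ X.refl , Y.refl ]
  ; sym   = λ n → [ X.sym (n ∘ inj₁) , Y.sym (n ∘ inj₂) ]
  ; trans = λ n m → [ X.trans (n ∘ inj₁) (m ∘ inj₁) , Y.trans (n ∘ inj₂) (m ∘ inj₂) ]
  }
  where
  module X = IsEquivalence dX
  module Y = IsEquivalence dY

int-isDitSet : {U : Set} (S : BinRel U) → IsDitSet (int S)
int-isDitSet S = ¬-isDitSet (EqClosure-isEquivalence (compl S))

int-greatest : {U : Set} {W S : BinRel U} → IsDitSet W → W ⇒ S → W ⇒ int S
int-greatest dW W⇒S w cl = EqClosure-minimal dW (λ ¬s w′ → ¬s (W⇒S w′)) cl w

⇒ʳ-⊇ : {U : Set} {X Y : BinRel U} → IsDitSet Y → Y ⇒ (X ⇒ʳ Y)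
⇒ʳ-⊇ dY = int-greatest dY inj₂

dit-isDitSet : {U : Set} (P : Partition U) → IsDitSet (dit P)
dit-isDitSet P = ¬-isDitSet (isEquivalence P)

⟦⟧ᵖ-isDitSet : {U : Set} (ψ : Formula) (ρ : ℕ → Partition U) → IsDitSet (⟦ ψ ⟧ᵖ ρ)
⟦⟧ᵖ-isDitSet (var n)  ρ = dit-isDitSet (ρ n)
⟦⟧ᵖ-isDitSet 𝟘        ρ = record { refl = λ () ; sym = λ _ () ; trans = λ _ _ () }
⟦⟧ᵖ-isDitSet 𝟙        ρ = ¬-isDitSet ≡.isEquivalence
⟦⟧ᵖ-isDitSet (σ ∨′ τ) ρ = ∪-isDitSet (⟦⟧ᵖ-isDitSet σ ρ) (⟦⟧ᵖ-isDitSet τ ρ)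
⟦⟧ᵖ-isDitSet (σ ∧′ τ) ρ = int-isDitSet _
⟦⟧ᵖ-isDitSet (σ ⇒′ τ) ρ = int-isDitSet _

⟦⟧ᵖ-irreflexive : {U : Set} (ψ : Formula) (ρ : ℕ → Partition U) → ⟦ ψ ⟧ᵖ ρ ⇒ _≢_
⟦⟧ᵖ-irreflexive ψ ρ d refl = IsEquivalence.refl (⟦⟧ᵖ-isDitSet ψ ρ) d

dit⊆⟦godel⟧ᵖ : {U : Set} (ρ : ℕ → Partition U) (π : ℕ) (ψ : Formula) →
  dit (ρ π) ⇒ ⟦ godel π ψ ⟧ᵖ ρ
dit⊆⟦godel⟧ᵖ ρ π (var n)  w = inj₂ w
dit⊆⟦godel⟧ᵖ ρ π 𝟘        w = w
dit⊆⟦godel⟧ᵖ ρ π 𝟙        w = ⟦⟧ᵖ-irreflexive (var π) ρ w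
dit⊆⟦godel⟧ᵖ ρ π (σ ∨′ τ) w = inj₁ (dit⊆⟦godel⟧ᵖ ρ π σ w)
dit⊆⟦godel⟧ᵖ ρ π (σ ⇒′ τ) w = ⇒ʳ-⊇ (⟦⟧ᵖ-isDitSet (godel π τ) ρ) (dit⊆⟦godel⟧ᵖ ρ π τ w)
dit⊆⟦godel⟧ᵖ ρ π (σ ∧′ τ) w = int-greatest dΠ (λ w′ → ⇒ʳ-⊇ dΠ w′ , ⇒ʳ-⊇ dΠ w′) w
  where dΠ = dit-isDitSet (ρ π)

⟦⟧ˢ-cong : {U V : Set} (ψ : Formula) (ρ₁ : ℕ → U → Set) (ρ₂ : ℕ → V → Set) (u : U) (v : V) →
  (∀ n → Occurs n ψ → ρ₁ n u ⇔ ρ₂ n v) → ⟦ ψ ⟧ˢ ρ₁ u ⇔ ⟦ ψ ⟧ˢ ρ₂ v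
⟦⟧ˢ-cong (var n)  ρ₁ ρ₂ u v agree = agree n refl
⟦⟧ˢ-cong 𝟘        ρ₁ ρ₂ u v agree = mk⇔ (λ ()) (λ ())
⟦⟧ˢ-cong 𝟙        ρ₁ ρ₂ u v agree = mk⇔ _ _
⟦⟧ˢ-cong (σ ∨′ τ) ρ₁ ρ₂ u v agree = mk⇔
  [ inj₁ ∘ Equivalence.to (⟦⟧ˢ-cong σ ρ₁ ρ₂ u v (λ n → agree n ∘ inj₁))
  , inj₂ ∘ Equivalence.to (⟦⟧ˢ-cong τ ρ₁ ρ₂ u v (λ n → agree n ∘ inj₂)) ]
  [ inj₁ ∘ Equivalence.from (⟦⟧ˢ-cong σ ρ₁ ρ₂ u v (λ n → agree n ∘ inj₁))
  , inj₂ ∘ Equivalence.from (⟦⟧ˢ-cong τ ρ₁ ρ₂ u v (λ n → agree n ∘ inj₂)) ]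
⟦⟧ˢ-cong (σ ∧′ τ) ρ₁ ρ₂ u v agree = mk⇔
  (λ (s , t) → Equivalence.to σ⇔ s , Equivalence.to τ⇔ t)
  (λ (s , t) → Equivalence.from σ⇔ s , Equivalence.from τ⇔ t)
  where
  σ⇔ = ⟦⟧ˢ-cong σ ρ₁ ρ₂ u v (λ n → agree n ∘ inj₁)
  τ⇔ = ⟦⟧ˢ-cong τ ρ₁ ρ₂ u v (λ n → agree n ∘ inj₂)
⟦⟧ˢ-cong (σ ⇒′ τ) ρ₁ ρ₂ u v agree = mk⇔
  [ (λ ¬s → inj₁ (¬s ∘ Equivalence.from σ⇔)) , inj₂ ∘ Equivalence.to τ⇔ ]
  [ (λ ¬s → inj₁ (¬s ∘ Equivalence.to σ⇔)) , inj₂ ∘ Equivalence.from τ⇔ ]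
  where
  σ⇔ = ⟦⟧ˢ-cong σ ρ₁ ρ₂ u v (λ n → agree n ∘ inj₁)
  τ⇔ = ⟦⟧ˢ-cong τ ρ₁ ρ₂ u v (λ n → agree n ∘ inj₂)

module _ (lem : ExcludedMiddle 0ℓ) where

  private
    dne : {A : Set} → ¬ ¬ A → A
    dne = em⇒dne lem

  int-⊆ : {U : Set} {S : BinRel U} → int S ⇒ S
  int-⊆ i = dne (λ ¬s → i (incl ¬s))

  dit-cotransitive : {U : Set} {X : BinRel U} → IsDitSet X → Cotransitive X
  dit-cotransitive {X = X} dX {x} {y} xy z with lem {X x z}
  ... | yes xz = inj₁ xz
  ... | no ¬xz = inj₂ (dne (λ ¬zy → IsEquivalence.trans dX ¬xz ¬zy xy))

  module Block {U : Set} (P : Partition U) (z : U) where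

    private
      module ≈ = IsEquivalence (isEquivalence P)

    Π : BinRel U
    Π = dit P

    InBlock : U → Set
    InBlock = SameBlock P z

    Splits : BinRel U → Set
    Splits X = ∃₂ λ c d → InBlock c × InBlock d × X c d

    Splits-mono : {X Y : BinRel U} → X ⇒ Y → Splits X → Splits Y
    Splits-mono X⇒Y (c , d , ic , jd , x) = c , d , ic , jd , X⇒Y x

    Splits-∪ : {X Y : BinRel U} → Splits (X ∪ Y) → Splits X ⊎ Splits Y
    Splits-∪ (c , d , ic , jd , inj₁ x) = inj₁ (c , d , ic , jd , x)
    Splits-∪ (c , d , ic , jd , inj₂ y) = inj₂ (c , d , ic , jd , y)

    Splits-≢ : {X : BinRel U} → Splits _≢_ → (∀ {c d} → InBlock c → c ≢ d → X c d) → Splits X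
    Splits-≢ (c , d , ic , jd , c≢d) full = c , d , ic , jd , full ic c≢d

    dit-¬Splits : ¬ Splits Π
    dit-¬Splits (c , d , ic , jd , ¬cd) = ¬cd (≈.trans (≈.sym ic) jd)

    -- Within the block of z the equivalence generated by the complement of S is the identity,
    -- because it is contained in the equivalence "same π-block, and equal inside z's block".
    int-≢ : {S : BinRel U} → Π ⇒ S → (∀ {p q} → InBlock p → InBlock q → p ≢ q → S p q) →
      ∀ {c d} → InBlock c → c ≢ d → int S c d
    int-≢ {S} Π⇒S full {c} ic c≢d cl = c≢d (proj₂ (EqClosure-minimal eqT ¬S⇒T cl) ic)
      where
      T : BinRel U
      T p q = SameBlock P p q × (InBlock p → p ≡ q)

      eqT : IsEquivalence T
      eqT = record
        { refl  = ≈.refl , λ _ → refl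
        ; sym   = λ (pq , f) → ≈.sym pq , λ iq → ≡.sym (f (≈.trans iq (≈.sym pq)))
        ; trans = λ (pq , f) (qr , g) → ≈.trans pq qr , λ ip → ≡.trans (f ip) (g (≈.trans ip pq))
        }

      ¬S⇒T : compl S ⇒ T
      ¬S⇒T ¬s = pq , λ ip → dne (λ p≢q → ¬s (full ip (≈.trans ip pq) p≢q))
        where pq = dne (λ ¬pq → ¬s (Π⇒S ¬pq))

    Splits-connected : {X R : BinRel U} → IsDitSet X → Splits X →
      (∀ {p q} → InBlock p → InBlock q → X p q → R p q) →
      ∀ {c d} → InBlock c → InBlock d → EqClosure R c d
    Splits-connected dX (p₀ , q₀ , i₀ , j₀ , x₀) edge {c} {d} ic jd
      with dit-cotransitive dX x₀ c
    ... | inj₁ x₀c with dit-cotransitive dX x₀c d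
    ...   | inj₁ x₀d = trans′ (sym′ (incl (edge i₀ ic x₀c))) (incl (edge i₀ jd x₀d))
    ...   | inj₂ xdc = sym′ (incl (edge jd ic xdc))
    Splits-connected dX (p₀ , q₀ , i₀ , j₀ , x₀) edge {c} {d} ic jd
        | inj₂ xcq₀ with dit-cotransitive dX xcq₀ d
    ...   | inj₁ xcd  = incl (edge ic jd xcd)
    ...   | inj₂ xdq₀ = trans′ (incl (edge ic j₀ xcq₀)) (sym′ (incl (edge jd j₀ xdq₀)))

    ⇒ʳ-≢ : {X Y : BinRel U} → Π ⇒ Y → ¬ Splits X → ∀ {c d} → InBlock c → c ≢ d → (X ⇒ʳ Y) c d
    ⇒ʳ-≢ Π⇒Y ¬sX = int-≢ (inj₂ ∘ Π⇒Y) (λ {p} {q} ip iq _ → inj₁ (λ x → ¬sX (p , q , ip , iq , x)))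

    ⇒ʳ-¬Splits : {X Y : BinRel U} → IsDitSet X → Splits X → ¬ Splits Y → ¬ Splits (X ⇒ʳ Y)
    ⇒ʳ-¬Splits {X} {Y} dX sX ¬sY (c , d , ic , jd , i) = i (Splits-connected dX sX edge ic jd)
      where
      edge : ∀ {p q} → InBlock p → InBlock q → X p q → compl (compl X ∪ Y) p q
      edge ip iq x (inj₁ ¬x) = ¬x x
      edge {p} {q} ip iq x (inj₂ y) = ¬sY (p , q , ip , iq , y)

    ¬¬-≢ : {X : BinRel U} → IsDitSet X → Splits X →
      ∀ {c d} → InBlock c → c ≢ d → ((X ⇒ʳ Π) ⇒ʳ Π) c d
    ¬¬-≢ dX sX = ⇒ʳ-≢ (λ w → w) (⇒ʳ-¬Splits dX sX dit-¬Splits)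

    module Nontrivial (nontrivial : Splits _≢_) where

      ¬¬-Splits⁻ : {X : BinRel U} → Splits ((X ⇒ʳ Π) ⇒ʳ Π) → Splits X
      ¬¬-Splits⁻ s = dne λ ¬sX →
        ⇒ʳ-¬Splits (int-isDitSet _) (Splits-≢ nontrivial (⇒ʳ-≢ (λ w → w) ¬sX)) dit-¬Splits s

      Splits-⇒ʳ : {X Y : BinRel U} → IsDitSet X → IsDitSet Y → Π ⇒ Y →
        Splits (X ⇒ʳ Y) ⇔ (¬ Splits X ⊎ Splits Y)
      Splits-⇒ʳ {Y = Y} dX dY Π⇒Y = mk⇔ to
        [ (λ ¬sX → Splits-≢ nontrivial (⇒ʳ-≢ Π⇒Y ¬sX)) , Splits-mono (⇒ʳ-⊇ dY) ]
        where
        to : Splits (_ ⇒ʳ Y) → ¬ Splits _ ⊎ Splits Y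
        to s with lem {Splits Y}
        ... | yes sY = inj₂ sY
        ... | no ¬sY = inj₁ (λ sX → ⇒ʳ-¬Splits dX sX ¬sY s)

      Splits-∧ʳ-¬¬ : {X Y : BinRel U} → IsDitSet X → IsDitSet Y →
        Splits (int (((X ⇒ʳ Π) ⇒ʳ Π) ∩ ((Y ⇒ʳ Π) ⇒ʳ Π))) ⇔ (Splits X × Splits Y)
      Splits-∧ʳ-¬¬ dX dY = mk⇔
        (λ s → ¬¬-Splits⁻ (Splits-mono (proj₁ ∘ int-⊆) s) , ¬¬-Splits⁻ (Splits-mono (proj₂ ∘ int-⊆) s))
        (λ (sX , sY) → Splits-≢ nontrivial
          (int-≢ (λ w → ⇒ʳ-⊇ dΠ w , ⇒ʳ-⊇ dΠ w) (λ ip _ p≢q → ¬¬-≢ dX sX ip p≢q , ¬¬-≢ dY sY ip p≢q)))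
        where dΠ = dit-isDitSet P

  module _ {U : Set} (ρ : ℕ → Partition U) (π : ℕ) (z : U) where

    open Block (ρ π) z

    splitValuation : ℕ → ⊤ → Set
    splitValuation n _ = Splits (dit (ρ n))

    godel-Splits : Splits _≢_ → (ψ : Formula) → ⟦ ψ ⟧ˢ splitValuation tt ⇔ Splits (⟦ godel π ψ ⟧ᵖ ρ)
    godel-Splits nontrivial (var n) =
      mk⇔ (Splits-mono inj₁) (λ s → [ (λ sn → sn) , (λ sπ → ⊥-elim (dit-¬Splits sπ)) ] (Splits-∪ s))
    godel-Splits nontrivial 𝟘 = mk⇔ (λ ()) dit-¬Splits
    godel-Splits nontrivial 𝟙 = mk⇔ (λ _ → nontrivial) _
    godel-Splits nontrivial (σ ∨′ τ) = mk⇔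
      [ Splits-mono inj₁ ∘ Equivalence.to (godel-Splits nontrivial σ)
      , Splits-mono inj₂ ∘ Equivalence.to (godel-Splits nontrivial τ) ]
      ([ inj₁ ∘ Equivalence.from (godel-Splits nontrivial σ)
       , inj₂ ∘ Equivalence.from (godel-Splits nontrivial τ) ] ∘ Splits-∪)
    godel-Splits nontrivial (σ ⇒′ τ) = mk⇔
      (Equivalence.from ⇒⇔ ∘ [ inj₁ ∘ (_∘ Equivalence.from σ⇔) , inj₂ ∘ Equivalence.to τ⇔ ])
      ([ inj₁ ∘ (_∘ Equivalence.to σ⇔) , inj₂ ∘ Equivalence.from τ⇔ ] ∘ Equivalence.to ⇒⇔)
      where
      σ⇔ = godel-Splits nontrivial σ
      τ⇔ = godel-Splits nontrivial τ
      ⇒⇔ = Nontrivial.Splits-⇒ʳ nontrivial (⟦⟧ᵖ-isDitSet (godel π σ) ρ)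
             (⟦⟧ᵖ-isDitSet (godel π τ) ρ) (dit⊆⟦godel⟧ᵖ ρ π τ)
    godel-Splits nontrivial (σ ∧′ τ) = mk⇔
      (λ (s , t) → Equivalence.from ∧⇔ (Equivalence.to σ⇔ s , Equivalence.to τ⇔ t))
      (λ s → let (sσ , sτ) = Equivalence.to ∧⇔ s in Equivalence.from σ⇔ sσ , Equivalence.from τ⇔ sτ)
      where
      σ⇔ = godel-Splits nontrivial σ
      τ⇔ = godel-Splits nontrivial τ
      ∧⇔ = Nontrivial.Splits-∧ʳ-¬¬ nontrivial (⟦⟧ᵖ-isDitSet (godel π σ) ρ) (⟦⟧ᵖ-isDitSet (godel π τ) ρ)

  subset⇒partition : (φ : Formula) (π : ℕ) →
    SubsetTautology φ → PartitionTautology ((godel π φ ⇒′ var π) ⇒′ var π)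
  subset⇒partition φ π taut U _ ρ x y = mk⇔ (⟦⟧ᵖ-irreflexive ((godel π φ ⇒′ var π) ⇒′ var π) ρ) distinct
    where
    open Block (ρ π) x

    distinct : x ≢ y → ((⟦ godel π φ ⟧ᵖ ρ ⇒ʳ Π) ⇒ʳ Π) x y
    distinct x≢y with lem {SameBlock (ρ π) x y}
    ... | yes x~y = ¬¬-≢ (⟦⟧ᵖ-isDitSet (godel π φ) ρ) splits x~x x≢y
      where
      x~x = IsEquivalence.refl (isEquivalence (ρ π))
      splits = Equivalence.to (godel-Splits ρ π x (x , y , x~x , x~y , x≢y) φ)
                 (taut ⊤ tt (splitValuation ρ π x) tt)
    ... | no x≁y = ⇒ʳ-⊇ (dit-isDitSet (ρ π)) x≁y

  twoPoint : Set → Partition Bool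
  twoPoint A = record
    { SameBlock = λ x y → A → x ≡ y
    ; isEquivalence = record
      { refl = λ _ → refl ; sym = λ f a → ≡.sym (f a) ; trans = λ f g a → ≡.trans (f a) (g a) }
    }

  partition⇒subset : (φ : Formula) (π : ℕ) → ¬ Occurs π φ →
    PartitionTautology ((godel π φ ⇒′ var π) ⇒′ var π) → SubsetTautology φ
  partition⇒subset φ π π∉φ taut U _ ρ u =
    Equivalence.to (⟦⟧ˢ-cong φ (splitValuation ρ′ π true) ρ tt u agree)
      (Equivalence.from (godel-Splits ρ′ π true nontrivial φ) (Nontrivial.¬¬-Splits⁻ nontrivial ¬¬G))
    where
    ρ′ : ℕ → Partition Bool
    ρ′ m = twoPoint (ρ m u × π ≢ m)

    open Block (ρ′ π) true

    inBlock : ∀ {c} → InBlock c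
    inBlock (_ , π≢π) = ⊥-elim (π≢π refl)

    true≢false : true ≢ false
    true≢false ()

    nontrivial : Splits _≢_
    nontrivial = true , false , inBlock , inBlock , true≢false

    ¬¬G : Splits ((⟦ godel π φ ⟧ᵖ ρ′ ⇒ʳ Π) ⇒ʳ Π)
    ¬¬G = true , false , inBlock , inBlock , Equivalence.from (taut Bool nontrivial′ ρ′ true false) true≢false
      where nontrivial′ = true , false , true≢false

    agree : ∀ n → Occurs n φ → splitValuation ρ′ π true n tt ⇔ ρ n u
    agree n n∈φ = mk⇔
      (λ (_ , _ , _ , _ , ¬same) → dne (λ ¬r → ¬same (λ (r , _) → ⊥-elim (¬r r))))
      (λ r → true , false , inBlock , inBlock , λ same → true≢false (same (r , π≢n)))
      where
      π≢n : π ≢ n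
      π≢n refl = π∉φ n∈φ

mainTheorem17 : ExcludedMiddle 0ℓ → (φ : Formula) (π : ℕ) → ¬ Occurs π φ →
    SubsetTautology φ ⇔ PartitionTautology ((godel π φ ⇒′ var π) ⇒′ var π)
mainTheorem17 lem φ π π∉φ = mk⇔ (subset⇒partition lem φ π) (partition⇒subset lem φ π π∉φ)
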